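{- Let $b\geq 2$ be an integer, let $x=[0;a_1,a_2,\dots]\in T_b$, and suppose $a_2$ has $l$ digits in base $b$, where $l\geq 2$. (i) If $b=k^2+1$ with $k\geq 3$ an integer, then $a_2=\frac{(k^2+1)^l-(k^2+1)}{k}-1$. This formula is also valid when $b=5$ (i.e. $k=2$) and $l\geq 3$. (ii) If $b=k^2+k$ with $k\geq 2$ an integer, then $a_2=b^l-2=(k^2+k)^l-2$.
   Context: A real number $x$ is a Trott number in base $b$ if $x\in(0,1)$ has an infinite continued fraction expansion $x=[0;a_1,a_2,\dots]$ with all $a_i$ positive integers and the base-$b$ expansion of $x$ is $(0.\hat{a}_1\hat{a}_2\hat{a}_3\dots)_b$, where $\hat{a}_i$ is the string of base-$b$ digits of $a_i$ (without leading zeros), concatenated. $T_b$ is the set of Trott numbers in base $b$. -}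

module Defs where

open import Data.Nat using (ℕ; zero; suc; _+_; _*_; _∸_; _^_; _≤_; _<_; _<?_; NonZero; ∣_-_∣)
open import Data.Nat.DivMod using (_/_)
open import Data.Product using (_×_; _,_; proj₁; proj₂; ∃)
open import Relation.Nullary using (yes; no)

-- Number of base-b digits of n (n ≥ 1): 1 if n < b, else 1 + digits of ⌊n/b⌋.
-- The first argument is fuel; fuel n suffices since n/b < n for n ≥ b ≥ 2.
digitsAux : (b : ℕ) .{{_ : NonZero b}} → ℕ → ℕ → ℕ
digitsAux b zero    n = 1
digitsAux b (suc f) n with n <? b
... | yes _ = 1
... | no  _ = suc (digitsAux b f (n / b))

numDigits : (b : ℕ) .{{_ : NonZero b}} → ℕ → ℕ
numDigits b n = digitsAux b n n

-- Partial quotients are given as a : ℕ → ℕ with  a i = a_{i+1},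
-- i.e. x = [0; a 0, a 1, a 2, ...].

-- Convergents: state (p_{n-1}, q_{n-1}, p_n, q_n), with p_{-1}=1,q_{-1}=0,p_0=0,q_0=1.
cfState : (ℕ → ℕ) → ℕ → ℕ × ℕ × ℕ × ℕ
cfState a zero = 1 , 0 , 0 , 1
cfState a (suc n) with cfState a n
... | (p' , q' , p , q) = p , q , a n * p + p' , a n * q + q'

cfP cfQ : (ℕ → ℕ) → ℕ → ℕ
cfP a n = proj₁ (proj₂ (proj₂ (cfState a n)))
cfQ a n = proj₂ (proj₂ (proj₂ (cfState a n)))

-- Concatenated base-b expansion truncated after the first n blocks:
-- value = numer / b ^ expo, where the digit string is  â_1 â_2 ... â_n.
concState : (b : ℕ) .{{_ : NonZero b}} → (ℕ → ℕ) → ℕ → ℕ × ℕ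
concState b a zero = 0 , 0
concState b a (suc n) with concState b a n
... | (N , S) = N * b ^ numDigits b (a n) + a n , S + numDigits b (a n)

concNum concExp : (b : ℕ) .{{_ : NonZero b}} → (ℕ → ℕ) → ℕ → ℕ
concNum b a n = proj₁ (concState b a n)
concExp b a n = proj₂ (concState b a n)

-- Trott: all a_i ≥ 1 (infinite continued fraction with positive partial
-- quotients) and the real number [0;a_1,a_2,...] = lim p_n/q_n equals the
-- real number (0.â_1 â_2 ...)_b = lim concNum_n / b^concExp_n, i.e. the
-- difference of the two rational sequences tends to 0:
--   ∀ k ∃ N ∀ n ≥ N, | p_n/q_n − N_n/b^{S_n} | ≤ 1/(k+1)   (cleared of denominators).
IsTrott : (b : ℕ) .{{_ : NonZero b}} → (ℕ → ℕ) → Set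
IsTrott b a =
  (∀ i → 1 ≤ a i) ×
  (∀ k → ∃ λ N → ∀ n → N ≤ n →
     suc k * ∣ cfP a n * b ^ concExp b a n - concNum b a n * cfQ a n ∣
       ≤ cfQ a n * b ^ concExp b a n)

{-# OPTIONS --safe #-}
-- Let x = [0; a₀, a₁, …] = (0.â₀ â₁ …)_b (indices as in the code: a₀ = a 0 is the
-- paper's a₁) and C = b ^ l. The convergents and the truncated expansions both tend
-- to x, so any bound on x from one side can be played against one from the other,
-- already after two blocks. Comparing x ≤ 1/a₀ with x ≥ (0.â₀â₁)_b gives a₀² < b, and
-- x ≥ a₁/(a₀a₁+1) with x ≤ (0.â₀â₁)_b + 1/(bC) gives b ≤ a₀(a₀+1); so a₀ = k when
-- b = k²+1 or b = k²+k. With a₀ = k, the bounds a₁/(ka₁+1) ≤ x ≤ (a₁+1)/(k(a₁+1)+1)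
-- confine C to a short window, which contains a single admissible value:
-- C = k(a₁+1) + b (the only one ≡ 1 mod k) for b = k²+1, and C = a₁ + 2 for b = k²+k.
module Submission where

open import Defs
open import Data.Nat
open import Data.Nat.Properties
open import Data.Nat.DivMod
open import Data.Product
open import Data.Sum using (_⊎_; inj₁; inj₂)
open import Data.Empty using (⊥; ⊥-elim)
open import Function using (_∘_)
open import Relation.Nullary using (yes; no)
open import Relation.Binary.Definitions using (tri<; tri≈; tri>)
open import Relation.Binary.PropositionalEquality
open import Data.Nat.Tactic.RingSolver
open import Algebra.Properties.CommutativeSemigroup *-commutativeSemigroup using (xy∙z≈xz∙y)

digitsAux-bounds : ∀ b .{{_ : NonZero b}} → 2 ≤ b → ∀ f n → 1 ≤ n → n ≤ f →
  1 ≤ digitsAux b f n × n < b ^ digitsAux b f n × b ^ (digitsAux b f n ∸ 1) ≤ n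
digitsAux-bounds b b≥2 zero    n n≥1 n≤0 = ⊥-elim (<⇒≱ n≥1 n≤0)
digitsAux-bounds b b≥2 (suc f) n n≥1 n≤f with n <? b
... | yes n<b = s≤s z≤n , subst (n <_) (sym (*-identityʳ b)) n<b , n≥1
... | no  n≮b = s≤s z≤n , upper , lower
  where
  instance _ = >-nonZero n≥1
  IH = digitsAux-bounds b b≥2 f (n / b) (m≥n⇒m/n>0 (≮⇒≥ n≮b)) (≤-pred (≤-trans (m/n<m n b b≥2) n≤f))
  d = digitsAux b f (n / b)
  upper : n < b * b ^ d
  upper = begin-strict
    n                    ≡⟨ m≡m%n+[m/n]*n n b ⟩
    n % b + (n / b) * b  <⟨ +-monoˡ-< ((n / b) * b) (m%n<n n b) ⟩
    suc (n / b) * b      ≤⟨ *-monoˡ-≤ b (proj₁ (proj₂ IH)) ⟩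
    b ^ d * b            ≡⟨ *-comm (b ^ d) b ⟩
    b * b ^ d            ∎
    where open ≤-Reasoning
  lower : b ^ d ≤ n
  lower = begin
    b ^ d                ≡⟨ cong (b ^_) (sym (m∸n+n≡m (proj₁ IH))) ⟩
    b ^ (d ∸ 1 + 1)      ≡⟨ cong (b ^_) (+-comm (d ∸ 1) 1) ⟩
    b * b ^ (d ∸ 1)      ≤⟨ *-monoʳ-≤ b (proj₂ (proj₂ IH)) ⟩
    b * (n / b)          ≡⟨ *-comm b (n / b) ⟩
    (n / b) * b          ≤⟨ m/n*n≤m n b ⟩
    n                    ∎
    where open ≤-Reasoning

numDigits-bounds : ∀ b .{{_ : NonZero b}} → 2 ≤ b → ∀ n → 1 ≤ n →
  n < b ^ numDigits b n × b ^ (numDigits b n ∸ 1) ≤ n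
numDigits-bounds b b≥2 n n≥1 = proj₂ (digitsAux-bounds b b≥2 n n n≥1 ≤-refl)

cfStep : ℕ → ℕ × ℕ × ℕ × ℕ → ℕ × ℕ × ℕ × ℕ
cfStep c (p′ , q′ , p , q) = p , q , c * p + p′ , c * q + q′

shiftState : ℕ → ℕ × ℕ × ℕ × ℕ → ℕ × ℕ × ℕ × ℕ
shiftState c (p′ , q′ , p , q) = q′ , c * q′ + p′ , q , c * q + p

cfStep-shiftState : ∀ c d s → cfStep c (shiftState d s) ≡ shiftState d (cfStep c s)
cfStep-shiftState c d (p′ , q′ , p , q) = cong (λ z → q , d * q + p , c * q + q′ , z) (commute c d p′ q′ p q)
  where
  commute : ∀ c d p′ q′ p q → c * (d * q + p) + (d * q′ + p′) ≡ d * (c * q + q′) + (c * p + p′)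
  commute = solve-∀

cfState-tail : ∀ a n → cfState a (suc n) ≡ shiftState (a 0) (cfState (a ∘ suc) n)
cfState-tail a zero rewrite *-zeroʳ (a 0) = refl
cfState-tail a (suc n) = begin
  cfStep (a (suc n)) (cfState a (suc n))                         ≡⟨ cong (cfStep (a (suc n))) (cfState-tail a n) ⟩
  cfStep (a (suc n)) (shiftState (a 0) (cfState (a ∘ suc) n))    ≡⟨ cfStep-shiftState (a (suc n)) (a 0) (cfState (a ∘ suc) n) ⟩
  shiftState (a 0) (cfState (a ∘ suc) (suc n))                   ∎
  where open ≡-Reasoning

module _ (a : ℕ → ℕ) (n : ℕ) where
  cfP-tail : cfP a (suc n) ≡ cfQ (a ∘ suc) n
  cfP-tail = cong (proj₁ ∘ proj₂ ∘ proj₂) (cfState-tail a n)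

  cfQ-tail : cfQ a (suc n) ≡ a 0 * cfQ (a ∘ suc) n + cfP (a ∘ suc) n
  cfQ-tail = cong (proj₂ ∘ proj₂ ∘ proj₂) (cfState-tail a n)

m≤a*m+n : ∀ {a} m n → 1 ≤ a → m ≤ a * m + n
m≤a*m+n {suc a} m n _ = ≤-trans (m≤m+n m (a * m)) (m≤m+n _ n)

cfQ-positive : ∀ a → (∀ i → 1 ≤ a i) → ∀ n → 1 ≤ cfQ a n
cfQ-positive a pos zero    = ≤-refl
cfQ-positive a pos (suc n) = begin
  1                                           ≤⟨ cfQ-positive (a ∘ suc) (pos ∘ suc) n ⟩
  cfQ (a ∘ suc) n                             ≤⟨ m≤a*m+n _ _ (pos 0) ⟩
  a 0 * cfQ (a ∘ suc) n + cfP (a ∘ suc) n     ≡⟨ cfQ-tail a n ⟨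
  cfQ a (suc n)                               ∎
  where open ≤-Reasoning

cfP≤cfQ : ∀ a → (∀ i → 1 ≤ a i) → ∀ n → cfP a n ≤ cfQ a n
cfP≤cfQ a pos zero    = z≤n
cfP≤cfQ a pos (suc n) = begin
  cfP a (suc n)                               ≡⟨ cfP-tail a n ⟩
  cfQ (a ∘ suc) n                             ≤⟨ m≤a*m+n _ _ (pos 0) ⟩
  a 0 * cfQ (a ∘ suc) n + cfP (a ∘ suc) n     ≡⟨ cfQ-tail a n ⟨
  cfQ a (suc n)                               ∎
  where open ≤-Reasoning

a₀*cfP≤cfQ : ∀ a n → a 0 * cfP a (suc n) ≤ cfQ a (suc n)
a₀*cfP≤cfQ a n = begin
  a 0 * cfP a (suc n)                         ≡⟨ cong (a 0 *_) (cfP-tail a n) ⟩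
  a 0 * cfQ (a ∘ suc) n                       ≤⟨ m≤m+n _ _ ⟩
  a 0 * cfQ (a ∘ suc) n + cfP (a ∘ suc) n     ≡⟨ cfQ-tail a n ⟨
  cfQ a (suc n)                               ∎
  where open ≤-Reasoning

cfQ≤[a₀+1]*cfP : ∀ a → (∀ i → 1 ≤ a i) → ∀ n → cfQ a (suc n) ≤ (a 0 + 1) * cfP a (suc n)
cfQ≤[a₀+1]*cfP a pos n = begin
  cfQ a (suc n)                               ≡⟨ cfQ-tail a n ⟩
  a 0 * s + cfP (a ∘ suc) n                   ≤⟨ +-monoʳ-≤ (a 0 * s) (cfP≤cfQ (a ∘ suc) (pos ∘ suc) n) ⟩
  a 0 * s + s                                 ≡⟨ +-comm (a 0 * s) s ⟩
  suc (a 0) * s                               ≡⟨ cong (_* s) (+-comm 1 (a 0)) ⟩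
  (a 0 + 1) * s                               ≡⟨ cong ((a 0 + 1) *_) (cfP-tail a n) ⟨
  (a 0 + 1) * cfP a (suc n)                   ∎
  where open ≤-Reasoning
        s = cfQ (a ∘ suc) n

a₁*cfQ≤[a₀a₁+1]*cfP : ∀ a n → a 1 * cfQ a (2 + n) ≤ (a 0 * a 1 + 1) * cfP a (2 + n)
a₁*cfQ≤[a₀a₁+1]*cfP a n = begin
  a 1 * cfQ a (2 + n)                         ≡⟨ cong (a 1 *_) (cfQ-tail a (suc n)) ⟩
  a 1 * (a 0 * s + r)                         ≡⟨ distrib (a 0) (a 1) s r ⟩
  a 0 * a 1 * s + a 1 * r                     ≤⟨ +-monoʳ-≤ (a 0 * a 1 * s) (a₀*cfP≤cfQ (a ∘ suc) n) ⟩
  a 0 * a 1 * s + s                           ≡⟨ collect (a 0 * a 1) s ⟩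
  (a 0 * a 1 + 1) * s                         ≡⟨ cong ((a 0 * a 1 + 1) *_) (cfP-tail a (suc n)) ⟨
  (a 0 * a 1 + 1) * cfP a (2 + n)             ∎
  where open ≤-Reasoning
        s = cfQ (a ∘ suc) (suc n)
        r = cfP (a ∘ suc) (suc n)
        distrib : ∀ x y s r → y * (x * s + r) ≡ x * y * s + y * r
        distrib = solve-∀
        collect : ∀ x s → x * s + s ≡ (x + 1) * s
        collect = solve-∀

[a₀[a₁+1]+1]*cfP≤[a₁+1]*cfQ : ∀ a → (∀ i → 1 ≤ a i) → ∀ n →
  (a 0 * (a 1 + 1) + 1) * cfP a (2 + n) ≤ (a 1 + 1) * cfQ a (2 + n)
[a₀[a₁+1]+1]*cfP≤[a₁+1]*cfQ a pos n = begin
  (a 0 * (a 1 + 1) + 1) * cfP a (2 + n)       ≡⟨ cong ((a 0 * (a 1 + 1) + 1) *_) (cfP-tail a (suc n)) ⟩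
  (a 0 * (a 1 + 1) + 1) * s                   ≡⟨ distrib (a 0) (a 1) s ⟩
  (a 1 + 1) * (a 0 * s) + s                   ≤⟨ +-monoʳ-≤ ((a 1 + 1) * (a 0 * s)) (cfQ≤[a₀+1]*cfP (a ∘ suc) (pos ∘ suc) n) ⟩
  (a 1 + 1) * (a 0 * s) + (a 1 + 1) * r       ≡⟨ *-distribˡ-+ (a 1 + 1) (a 0 * s) r ⟨
  (a 1 + 1) * (a 0 * s + r)                   ≡⟨ cong ((a 1 + 1) *_) (cfQ-tail a (suc n)) ⟨
  (a 1 + 1) * cfQ a (2 + n)                   ∎
  where open ≤-Reasoning
        s = cfQ (a ∘ suc) (suc n)
        r = cfP (a ∘ suc) (suc n)
        distrib : ∀ x y s → (x * (y + 1) + 1) * s ≡ (y + 1) * (x * s) + s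
        distrib = solve-∀

module _ (b : ℕ) .{{_ : NonZero b}} (a : ℕ → ℕ) where
  private
    N E D : ℕ → ℕ
    N = concNum b a
    E n = b ^ concExp b a n
    D n = b ^ numDigits b (a n)

    E-suc : ∀ n → E (suc n) ≡ E n * D n
    E-suc n = ^-distribˡ-+-* b (concExp b a n) (numDigits b (a n))

  concNum-mono : ∀ {m n} → m ≤′ n → concNum b a m * b ^ concExp b a n ≤ concNum b a n * b ^ concExp b a m
  concNum-mono ≤′-refl = ≤-refl
  concNum-mono {m} (≤′-step {n} m≤n) = begin
    N m * E (suc n)            ≡⟨ cong (N m *_) (E-suc n) ⟩
    N m * (E n * D n)          ≡⟨ *-assoc (N m) (E n) (D n) ⟨
    N m * E n * D n            ≤⟨ *-monoˡ-≤ (D n) (concNum-mono m≤n) ⟩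
    N n * E m * D n            ≡⟨ xy∙z≈xz∙y (N n) (E m) (D n) ⟩
    N n * D n * E m            ≤⟨ *-monoˡ-≤ (E m) (m≤m+n (N n * D n) (a n)) ⟩
    N (suc n) * E m            ∎
    where open ≤-Reasoning

  concNum-bound : 2 ≤ b → (∀ i → 1 ≤ a i) → ∀ {m n} → m ≤′ n →
    (concNum b a n + 1) * b ^ concExp b a m ≤ (concNum b a m + 1) * b ^ concExp b a n
  concNum-bound b≥2 pos ≤′-refl = ≤-refl
  concNum-bound b≥2 pos {m} (≤′-step {n} m≤n) = begin
    (N (suc n) + 1) * E m          ≤⟨ *-monoˡ-≤ (E m) next-block ⟩
    (N n + 1) * D n * E m          ≡⟨ xy∙z≈xz∙y (N n + 1) (D n) (E m) ⟩
    (N n + 1) * E m * D n          ≤⟨ *-monoˡ-≤ (D n) (concNum-bound b≥2 pos m≤n) ⟩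
    (N m + 1) * E n * D n          ≡⟨ *-assoc (N m + 1) (E n) (D n) ⟩
    (N m + 1) * (E n * D n)        ≡⟨ cong ((N m + 1) *_) (E-suc n) ⟨
    (N m + 1) * E (suc n)          ∎
    where
    open ≤-Reasoning
    next-block : N (suc n) + 1 ≤ (N n + 1) * D n
    next-block = begin
      N n * D n + a n + 1      ≡⟨ +-assoc (N n * D n) (a n) 1 ⟩
      N n * D n + (a n + 1)    ≤⟨ +-monoʳ-≤ (N n * D n) (subst (_≤ D n) (+-comm 1 (a n)) (proj₁ (numDigits-bounds b b≥2 (a n) (pos n)))) ⟩
      N n * D n + D n          ≡⟨ +-comm (N n * D n) (D n) ⟩
      suc (N n) * D n          ≡⟨ cong (_* D n) (+-comm 1 (N n)) ⟩
      (N n + 1) * D n          ∎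

record FractionsConverge (p q r s : ℕ → ℕ) : Set where
  constructor fractionsConverge
  field
    converges : ∀ k → ∃ λ N → ∀ n → N ≤ n → suc k * ∣ p n * s n - r n * q n ∣ ≤ q n * s n

fractionsConverge-sym : ∀ {p q r s} → FractionsConverge p q r s → FractionsConverge r s p q
fractionsConverge-sym {p} {q} {r} {s} (fractionsConverge conv) = fractionsConverge λ k → proj₁ (conv k) , λ n N≤n →
  subst₂ (λ t M → suc k * t ≤ M) (∣-∣-comm (p n * s n) (r n * q n)) (*-comm (q n) (s n))
    (proj₂ (conv k) n N≤n)

≤-across-limit : ∀ {p q r s} → FractionsConverge p q r s → (∀ n → 1 ≤ q n * s n) →
  ∀ m u v w z → (∀ n → u * q (m + n) ≤ v * p (m + n)) → (∀ n → r (m + n) * z ≤ w * s (m + n)) →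
  u * z ≤ w * v
≤-across-limit {p} {q} {r} {s} (fractionsConverge conv) qs>0 m u v w z u/v≤p/q r/s≤w/z with u * z ≤? w * v
... | yes uz≤wv = uz≤wv
... | no  uz≰wv =
  ⊥-elim (<⇒≱ (qs>0 n) (≤-trans M≤vz*t (≤-reflexive (trans (cong (v * z *_) t≡0) (*-zeroʳ (v * z))))))
  where
  N = proj₁ (conv (v * z))
  n = m + N
  M = q n * s n
  t = ∣ p n * s n - r n * q n ∣
  gap : v * z * (r n * q n) + M ≤ v * z * (p n * s n)
  gap = begin
    v * z * (r n * q n) + M      ≡⟨ cong (_+ M) (e₁ v z (r n) (q n)) ⟩
    v * q n * (r n * z) + M      ≤⟨ +-monoˡ-≤ M (*-monoʳ-≤ (v * q n) (r/s≤w/z N)) ⟩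
    v * q n * (w * s n) + M      ≡⟨ e₂ v w (q n) (s n) ⟩
    (w * v + 1) * M              ≤⟨ *-monoˡ-≤ M (subst (_≤ u * z) (+-comm 1 (w * v)) (≰⇒> uz≰wv)) ⟩
    u * z * M                    ≡⟨ e₃ u z (q n) (s n) ⟩
    z * s n * (u * q n)          ≤⟨ *-monoʳ-≤ (z * s n) (u/v≤p/q N) ⟩
    z * s n * (v * p n)          ≡⟨ e₄ v z (p n) (s n) ⟩
    v * z * (p n * s n)          ∎
    where
    open ≤-Reasoning
    e₁ : ∀ v z r q → v * z * (r * q) ≡ v * q * (r * z)
    e₁ = solve-∀
    e₂ : ∀ v w q s → v * q * (w * s) + q * s ≡ (w * v + 1) * (q * s)
    e₂ = solve-∀
    e₃ : ∀ u z q s → u * z * (q * s) ≡ z * s * (u * q)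
    e₃ = solve-∀
    e₄ : ∀ v z p s → z * s * (v * p) ≡ v * z * (p * s)
    e₄ = solve-∀
  M≤vz*t : M ≤ v * z * t
  M≤vz*t = +-cancelˡ-≤ (v * z * (r n * q n)) M (v * z * t) (begin
    v * z * (r n * q n) + M      ≤⟨ gap ⟩
    v * z * (p n * s n)          ≤⟨ *-monoʳ-≤ (v * z) (m≤n+∣m-n∣ (p n * s n) (r n * q n)) ⟩
    v * z * (r n * q n + t)      ≡⟨ *-distribˡ-+ (v * z) (r n * q n) t ⟩
    v * z * (r n * q n) + v * z * t ∎)
    where open ≤-Reasoning
  t≡0 : t ≡ 0
  t≡0 = n≤0⇒n≡0 (+-cancelʳ-≤ (v * z * t) t 0 (≤-trans (proj₂ (conv (v * z)) n (m≤n+m N m)) M≤vz*t))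

module _ (b : ℕ) .{{_ : NonZero b}} (b≥2 : 2 ≤ b) (a : ℕ → ℕ) (trott : IsTrott b a) where
  private
    pos = proj₁ trott

    N E : ℕ → ℕ
    N = concNum b a
    E n = b ^ concExp b a n

    cf~E : FractionsConverge (cfP a) (cfQ a) N E
    cf~E = fractionsConverge (proj₂ trott)

    E~cf : FractionsConverge N E (cfP a) (cfQ a)
    E~cf = fractionsConverge-sym cf~E

    QE>0 : ∀ n → 1 ≤ cfQ a n * E n
    QE>0 n = *-mono-≤ (cfQ-positive a pos n) (m^n>0 b (concExp b a n))

    EQ>0 : ∀ n → 1 ≤ E n * cfQ a n
    EQ>0 n = subst (1 ≤_) (*-comm (cfQ a n) (E n)) (QE>0 n)

    N₂/E₂≤N/E : ∀ n → N 2 * E (2 + n) ≤ E 2 * N (2 + n)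
    N₂/E₂≤N/E n = subst (N 2 * E (2 + n) ≤_) (*-comm (N (2 + n)) (E 2)) (concNum-mono b a (m≤′m+n 2 n))

    N/E≤[N₂+1]/E₂ : ∀ n → N (2 + n) * E 2 ≤ (N 2 + 1) * E (2 + n)
    N/E≤[N₂+1]/E₂ n = ≤-trans (*-monoˡ-≤ (E 2) (m≤m+n (N (2 + n)) 1)) (concNum-bound b a b≥2 pos (m≤′m+n 2 n))

    cf≤1/a₀ : ∀ n → cfP a (2 + n) * a 0 ≤ 1 * cfQ a (2 + n)
    cf≤1/a₀ n = subst₂ _≤_ (*-comm (a 0) (cfP a (2 + n))) (sym (*-identityˡ _)) (a₀*cfP≤cfQ a (suc n))

    cf≤[a₁+1]/[a₀[a₁+1]+1] : ∀ n → cfP a (2 + n) * (a 0 * (a 1 + 1) + 1) ≤ (a 1 + 1) * cfQ a (2 + n)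
    cf≤[a₁+1]/[a₀[a₁+1]+1] n = subst (_≤ (a 1 + 1) * cfQ a (2 + n)) (*-comm _ (cfP a (2 + n)))
                                  ([a₀[a₁+1]+1]*cfP≤[a₁+1]*cfQ a pos n)

    TwoBlockBounds : ℕ → Set
    TwoBlockBounds BC =
      N 2 * a 0 ≤ BC ×
      a 1 * BC ≤ (N 2 + 1) * (a 0 * a 1 + 1) ×
      N 2 * (a 0 * (a 1 + 1) + 1) ≤ (a 1 + 1) * BC

  -- With x the common limit: N₂/E₂ ≤ x ≤ 1/a₀,  a₁/(a₀a₁+1) ≤ x ≤ (N₂+1)/E₂,
  -- and N₂/E₂ ≤ x ≤ (a₁+1)/(a₀(a₁+1)+1), where E₂ = B * C.
  trott-two-blocks : let B = b ^ numDigits b (a 0) ; C = b ^ numDigits b (a 1) in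
    (a 0 * C + a 1) * a 0 ≤ B * C ×
    a 1 * (B * C) ≤ (a 0 * C + a 1 + 1) * (a 0 * a 1 + 1) ×
    (a 0 * C + a 1) * (a 0 * (a 1 + 1) + 1) ≤ (a 1 + 1) * (B * C)
  trott-two-blocks = subst TwoBlockBounds (^-distribˡ-+-* b (numDigits b (a 0)) (numDigits b (a 1)))
    ( subst (N 2 * a 0 ≤_) (*-identityˡ (E 2))
        (≤-across-limit E~cf EQ>0 2 (N 2) (E 2) 1 (a 0) N₂/E₂≤N/E cf≤1/a₀)
    , ≤-across-limit cf~E QE>0 2 (a 1) (a 0 * a 1 + 1) (N 2 + 1) (E 2) (a₁*cfQ≤[a₀a₁+1]*cfP a) N/E≤[N₂+1]/E₂
    , ≤-across-limit E~cf EQ>0 2 (N 2) (E 2) (a 1 + 1) (a 0 * (a 1 + 1) + 1) N₂/E₂≤N/E cf≤[a₁+1]/[a₀[a₁+1]+1] )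

contradiction-by-slack : ∀ {L R X Y} → L ≤ R → L + X ≡ R + Y → X < Y → ⊥
contradiction-by-slack {L} {R} {X} {Y} L≤R eq X<Y = <-irrefl refl (begin-strict
  R + Y   ≡⟨ eq ⟨
  L + X   ≤⟨ +-monoˡ-≤ X L≤R ⟩
  R + X   <⟨ +-monoʳ-< R X<Y ⟩
  R + Y   ∎)
  where open ≤-Reasoning

k²+1-C-too-small : ∀ k m C → 2 ≤ k → C ≤ k * (k + (k + m)) + 1 →
  k * C + k * (k + m) * (k + m + 1) + (k + m) ≤ 1 * (k + m + 1) * C → ⊥
k²+1-C-too-small k m C k≥2 C≤ upper = contradiction-by-slack L≤R (identity k m) b<kb
  where
  L≤R : k * (k + m) * (k + m + 1) + (k + m) ≤ (m + 1) * (k * (k + (k + m)) + 1)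
  L≤R = begin
    k * (k + m) * (k + m + 1) + (k + m)   ≤⟨ +-cancelˡ-≤ (k * C) _ _ (subst₂ _≤_ (+-assoc (k * C) _ _) (split k m C) upper) ⟩
    (m + 1) * C                           ≤⟨ *-monoʳ-≤ (m + 1) C≤ ⟩
    (m + 1) * (k * (k + (k + m)) + 1)     ∎
    where
    open ≤-Reasoning
    split : ∀ k m C → 1 * (k + m + 1) * C ≡ k * C + (m + 1) * C
    split = solve-∀
  identity : ∀ k m → k * (k + m) * (k + m + 1) + (k + m) + (k * k + 1)
                     ≡ (m + 1) * (k * (k + (k + m)) + 1) + (k * k + 1) * k
  identity = solve-∀
  b<kb : k * k + 1 < (k * k + 1) * k
  b<kb = m<m*n (k * k + 1) k {{>-nonZero (m≤n+m 1 (k * k))}} k≥2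

<-by-slack : ∀ {A B X Y} → A + X ≤ B + Y → Y < X → A < B
<-by-slack {A} {B} {X} {Y} le Y<X = +-cancelʳ-< X A B (≤-<-trans le (+-monoʳ-< B Y<X))

k²+1-C-too-large : ∀ k m j → 2 ≤ k → 1 ≤ m → let C = k * (2 + (k + (k + m)) + j) + 1 in
  (k + 4) * (k * k + 1) ≤ C →
  1 * (k + m) * C ≤ k * C + (k + m + 1) * (k * (k + m) + 1) → ⊥
k²+1-C-too-large k m j k≥2 m≥1 C-large lower =
  contradiction-by-slack mC≤ (identity k m j) (<-≤-trans (<-by-slack C-large′ slack) k[m+j]≤km[1+j])
  where
  C = k * (2 + (k + (k + m)) + j) + 1
  mC≤ : m * C ≤ (k + m + 1) * (k * (k + m) + 1)
  mC≤ = +-cancelˡ-≤ (k * C) _ _ (≤-trans (≤-reflexive (split k m C)) lower)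
    where
    split : ∀ k m C → k * C + m * C ≡ 1 * (k + m) * C
    split = solve-∀
  identity : ∀ k m j → m * (k * (2 + (k + (k + m)) + j) + 1) + (k + 1) * (k * k + 1)
                       ≡ (k + m + 1) * (k * (k + m) + 1) + k * m * (1 + j)
  identity = solve-∀
  C-large′ : (k + 1) * (k * k + 1) + (3 * (k * k) + 3) ≤ k * (m + j) + (2 * (k * k) + 2 * k + 1)
  C-large′ = subst₂ _≤_ (e₁ k) (e₂ k m j) C-large
    where
    e₁ : ∀ k → (k + 4) * (k * k + 1) ≡ (k + 1) * (k * k + 1) + (3 * (k * k) + 3)
    e₁ = solve-∀
    e₂ : ∀ k m j → k * (2 + (k + (k + m)) + j) + 1 ≡ k * (m + j) + (2 * (k * k) + 2 * k + 1)
    e₂ = solve-∀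
  slack : 2 * (k * k) + 2 * k + 1 < 3 * (k * k) + 3
  slack = begin-strict
    2 * (k * k) + 2 * k + 1            ≤⟨ +-monoˡ-≤ 1 (+-monoʳ-≤ (2 * (k * k)) (*-monoˡ-≤ k k≥2)) ⟩
    2 * (k * k) + k * k + 1            <⟨ m<m+n _ z<s ⟩
    2 * (k * k) + k * k + 1 + 2        ≡⟨ e k ⟩
    3 * (k * k) + 3                    ∎
    where
    open ≤-Reasoning
    e : ∀ k → 2 * (k * k) + k * k + 1 + 2 ≡ 3 * (k * k) + 3
    e = solve-∀
  k[m+j]≤km[1+j] : k * (m + j) ≤ k * m * (1 + j)
  k[m+j]≤km[1+j] = begin
    k * (m + j)                        ≤⟨ *-monoʳ-≤ k (+-monoʳ-≤ m (m≤n*m j m {{>-nonZero m≥1}})) ⟩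
    k * (m + m * j)                    ≡⟨ e k m j ⟩
    k * m * (1 + j)                    ∎
    where
    open ≤-Reasoning
    e : ∀ k m j → k * (m + m * j) ≡ k * m * (1 + j)
    e = solve-∀

-- Since b ≡ 1 (mod k), C = b ^ l has the form k * Q + 1; compare Q with y + k + 1.
k²+1-C-exact : ∀ k y C Q → 2 ≤ k → k < y → C ≡ k * Q + 1 →
  (k + 4) * (k * k + 1) ≤ C →
  1 * y * C ≤ k * C + (y + 1) * (k * y + 1) →
  k * C + k * y * (y + 1) + y ≤ 1 * (y + 1) * C →
  C ≡ k * (y + 1) + (k * k + 1)
k²+1-C-exact k y C Q k≥2 k<y refl C-large lower upper with m≤n⇒∃[o]m+o≡n (<⇒≤ k<y)
... | m , refl with <-cmp Q (suc (k + (k + m)))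
...   | tri≈ _ refl _ = equal-case k m
  where
  equal-case : ∀ k m → k * suc (k + (k + m)) + 1 ≡ k * (k + m + 1) + (k * k + 1)
  equal-case = solve-∀
...   | tri< Q<X+1 _ _ =
  ⊥-elim (k²+1-C-too-small k m (k * Q + 1) k≥2 (+-monoˡ-≤ 1 (*-monoʳ-≤ k (m<1+n⇒m≤n Q<X+1))) upper)
...   | tri> _ _ X+1<Q with m≤n⇒∃[o]m+o≡n X+1<Q
...     | j , refl =
  ⊥-elim (k²+1-C-too-large k m j k≥2 (+-cancelˡ-≤ k 1 m (subst (_≤ k + m) (+-comm 1 k) k<y)) C-large lower)

k²+k-slack : ∀ k y t → 2 ≤ k → 6 ≤ y → 3 * k + 2 ≤ y ⊎ 1 ≤ t →
  y + 1 + 3 * k + k * t < k * y + k * y * t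
k²+k-slack k y t k≥2 y≥6 (inj₁ y-large) = +-mono-<-≤ y+1+3k<ky kt≤kyt
  where
  instance _ = >-nonZero (≤-trans z<s y≥6)
  kt≤kyt : k * t ≤ k * y * t
  kt≤kyt = *-monoˡ-≤ t (m≤m*n k y)
  y+1+3k<ky : y + 1 + 3 * k < k * y
  y+1+3k<ky = begin-strict
    y + 1 + 3 * k          <⟨ m<m+n _ z<s ⟩
    y + 1 + 3 * k + 1      ≡⟨ e y k ⟩
    y + (3 * k + 2)        ≤⟨ +-monoʳ-≤ y y-large ⟩
    y + y                  ≡⟨ cong (y +_) (+-identityʳ y) ⟨
    2 * y                  ≤⟨ *-monoˡ-≤ y k≥2 ⟩
    k * y                  ∎
    where
    open ≤-Reasoning
    e : ∀ y k → y + 1 + 3 * k + 1 ≡ y + (3 * k + 2)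
    e = solve-∀
k²+k-slack k y t k≥2 y≥6 (inj₂ t≥1) = begin-strict
  y + 1 + 3 * k + k * t    ≡⟨ +-assoc (y + 1) (3 * k) (k * t) ⟩
  y + 1 + (3 * k + k * t)  <⟨ +-mono-<-≤ y+1<ky 3k+kt≤kyt ⟩
  k * y + k * y * t        ∎
  where
  open ≤-Reasoning
  y+1<ky : y + 1 < k * y
  y+1<ky = begin-strict
    y + 1                  <⟨ +-monoʳ-< y (≤-trans (s≤s (s≤s z≤n)) y≥6) ⟩
    y + y                  ≡⟨ cong (y +_) (+-identityʳ y) ⟨
    2 * y                  ≤⟨ *-monoˡ-≤ y k≥2 ⟩
    k * y                  ∎
  3k+kt≤kyt : 3 * k + k * t ≤ k * y * t
  3k+kt≤kyt = begin
    3 * k + k * t          ≤⟨ +-monoˡ-≤ (k * t) (*-monoʳ-≤ 3 (m≤m*n k t {{>-nonZero t≥1}})) ⟩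
    3 * (k * t) + k * t    ≡⟨ e k t ⟩
    4 * (k * t)            ≤⟨ *-monoˡ-≤ (k * t) (≤-trans (s≤s (s≤s (s≤s (s≤s z≤n)))) y≥6) ⟩
    y * (k * t)            ≡⟨ e′ k y t ⟩
    k * y * t              ∎
    where
    e : ∀ k t → 3 * (k * t) + k * t ≡ 4 * (k * t)
    e = solve-∀
    e′ : ∀ k y t → y * (k * t) ≡ k * y * t
    e′ = solve-∀

6≤k*k+k : ∀ {k} → 2 ≤ k → 6 ≤ k * k + k
6≤k*k+k k≥2 = +-mono-≤ (*-mono-≤ k≥2 k≥2) k≥2

3k+5≤b*b : ∀ k → 2 ≤ k → let b = k * k + k in 3 * k + 5 ≤ b * b
3k+5≤b*b k k≥2 = begin
  3 * k + 5          ≤⟨ +-monoˡ-≤ 5 3k≤b ⟩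
  b + 5              ≤⟨ +-monoʳ-≤ b (*-monoʳ-≤ 5 (≤-trans (s≤s z≤n) (6≤k*k+k k≥2))) ⟩
  b + 5 * b          ≤⟨ *-monoˡ-≤ b (6≤k*k+k k≥2) ⟩
  b * b              ∎
  where
  open ≤-Reasoning
  b = k * k + k
  3k≤b : 3 * k ≤ b
  3k≤b = ≤-trans (≤-reflexive (e k)) (+-monoˡ-≤ k (*-monoˡ-≤ k k≥2))
    where
    e : ∀ k → 3 * k ≡ 2 * k + k
    e = solve-∀

k²+k-C-exact : ∀ k y C → 2 ≤ k → k * k + k ≤ y → (k * k + k) * (k * k + k) ≤ C →
  k * y * C ≤ k * C + (y + 1) * (k * y + 1) →
  k * C + k * y * (y + 1) + y ≤ k * (y + 1) * C →
  C ≡ 2 + y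
k²+k-C-exact k y C k≥2 b≤y b²≤C lower upper with <-cmp C (2 + y)
... | tri≈ _ C≡2+y _ = C≡2+y
... | tri< C<2+y _ _ = ⊥-elim (<⇒≱ (≤-trans (s≤s z≤n) (≤-trans (6≤k*k+k k≥2) b≤y)) y≤0)
  where
  open ≤-Reasoning
  y≤0 : y ≤ 0
  y≤0 = +-cancelˡ-≤ (k * y * (y + 1)) y 0 (begin
    k * y * (y + 1) + y          ≤⟨ +-cancelˡ-≤ (k * C) _ _ (subst₂ _≤_ (+-assoc (k * C) _ y) (e k y C) upper) ⟩
    k * y * C                    ≤⟨ *-monoʳ-≤ (k * y) (≤-trans (m<1+n⇒m≤n C<2+y) (≤-reflexive (+-comm 1 y))) ⟩
    k * y * (y + 1)              ≡⟨ +-identityʳ _ ⟨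
    k * y * (y + 1) + 0          ∎)
    where
    e : ∀ k y C → k * (y + 1) * C ≡ k * C + k * y * C
    e = solve-∀
... | tri> _ _ 2+y<C with m≤n⇒∃[o]m+o≡n 2+y<C
...   | t , refl = ⊥-elim (contradiction-by-slack lower (identity k y t)
                     (k²+k-slack k y t k≥2 (≤-trans (6≤k*k+k k≥2) b≤y) (large-y-or-t t b²≤C)))
  where
  identity : ∀ k y t → k * y * (3 + y + t) + (y + 1 + 3 * k + k * t)
                       ≡ k * (3 + y + t) + (y + 1) * (k * y + 1) + (k * y + k * y * t)
  identity = solve-∀
  large-y-or-t : ∀ t → (k * k + k) * (k * k + k) ≤ 3 + y + t → 3 * k + 2 ≤ y ⊎ 1 ≤ t
  large-y-or-t zero    b²≤3+y = inj₁ (+-cancelˡ-≤ 3 _ _ (subst₂ _≤_ (e k) (+-identityʳ (3 + y))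
                                   (≤-trans (3k+5≤b*b k k≥2) b²≤3+y)))
    where
    e : ∀ k → 3 * k + 5 ≡ 3 + (3 * k + 2)
    e = solve-∀
  large-y-or-t (suc t) _      = inj₂ (s≤s z≤n)

k*Q+1-pow : ∀ k m l → ∃ λ Q → (k * m + 1) ^ l ≡ k * Q + 1
k*Q+1-pow k m zero    = 0 , cong (_+ 1) (sym (*-zeroʳ k))
k*Q+1-pow k m (suc l) with k*Q+1-pow k m l
... | Q , eq = k * m * Q + m + Q , trans (cong ((k * m + 1) *_) eq) (e k m Q)
  where
  e : ∀ k m Q → (k * m + 1) * (k * Q + 1) ≡ k * (k * m * Q + m + Q) + 1
  e = solve-∀

lower-bound-reduced : ∀ k r y C → y * ((k * k + r) * C) ≤ (k * C + y + 1) * (k * y + 1) →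
  r * y * C ≤ k * C + (y + 1) * (k * y + 1)
lower-bound-reduced k r y C le = +-cancelˡ-≤ (k * k * y * C) _ _ (subst₂ _≤_ (e₁ k r y C) (e₂ k y C) le)
  where
  e₁ : ∀ k r y C → y * ((k * k + r) * C) ≡ k * k * y * C + r * y * C
  e₁ = solve-∀
  e₂ : ∀ k y C → (k * C + y + 1) * (k * y + 1) ≡ k * k * y * C + (k * C + (y + 1) * (k * y + 1))
  e₂ = solve-∀

upper-bound-reduced : ∀ k r y C → (k * C + y) * (k * (y + 1) + 1) ≤ (y + 1) * ((k * k + r) * C) →
  k * C + k * y * (y + 1) + y ≤ r * (y + 1) * C
upper-bound-reduced k r y C le = +-cancelˡ-≤ (k * k * (y + 1) * C) _ _ (subst₂ _≤_ (e₁ k y C) (e₂ k r y C) le)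
  where
  e₁ : ∀ k y C → (k * C + y) * (k * (y + 1) + 1) ≡ k * k * (y + 1) * C + (k * C + k * y * (y + 1) + y)
  e₁ = solve-∀
  e₂ : ∀ k r y C → (y + 1) * ((k * k + r) * C) ≡ k * k * (y + 1) * C + r * (y + 1) * C
  e₂ = solve-∀

x*x<b^d⇒d≡1 : ∀ b .{{_ : NonZero b}} x d → 1 ≤ x → b ^ (d ∸ 1) ≤ x → x * x < b ^ d → d ≡ 1
x*x<b^d⇒d≡1 b x zero          x≥1 _ x²<1 = ⊥-elim (<⇒≱ x²<1 (*-mono-≤ x≥1 x≥1))
x*x<b^d⇒d≡1 b x (suc zero)    _   _ _    = refl
x*x<b^d⇒d≡1 b x (suc (suc d)) _   b^d≤x x²<b^d = ⊥-elim (<⇒≱ x²<b^d (begin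
  b ^ (2 + d)             ≤⟨ ^-monoʳ-≤ b (s≤s (m≤n+m (suc d) d)) ⟩
  b ^ (suc d + suc d)     ≡⟨ ^-distribˡ-+-* b (suc d) (suc d) ⟩
  b ^ suc d * b ^ suc d   ≤⟨ *-mono-≤ b^d≤x b^d≤x ⟩
  x * x                   ∎))
  where open ≤-Reasoning

[x*C+y]*x≤B*C⇒x*x<B : ∀ x y B C → 1 ≤ x → 1 ≤ y → (x * C + y) * x ≤ B * C → x * x < B
[x*C+y]*x≤B*C⇒x*x<B x y B C x≥1 y≥1 le = *-cancelʳ-< C (x * x) B (begin-strict
  x * x * C               <⟨ m<m+n (x * x * C) (*-mono-≤ y≥1 x≥1) ⟩
  x * x * C + y * x       ≡⟨ e x y C ⟩
  (x * C + y) * x         ≤⟨ le ⟩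
  B * C                   ∎)
  where
  open ≤-Reasoning
  e : ∀ x y C → x * x * C + y * x ≡ (x * C + y) * x
  e = solve-∀

b≤x*[x+1] : ∀ b x y C → 1 ≤ x → b ≤ y → y < C →
  y * (b * C) ≤ (x * C + y + 1) * (x * y + 1) → b ≤ x * (x + 1)
b≤x*[x+1] b x y C x≥1 b≤y y<C lower with b ≤? x * (x + 1)
... | yes b≤ = b≤
... | no  b≰ = ⊥-elim (contradiction-by-slack cancelled (e₁ x y) x+1<y)
  where
  instance _ = >-nonZero (≤-trans (s≤s z≤n) y<C)
  x[x+1]+1≤b : x * (x + 1) + 1 ≤ b
  x[x+1]+1≤b = subst (_≤ b) (+-comm 1 _) (≰⇒> b≰)
  x+1<y : x + 1 < y
  x+1<y = ≤-trans (subst (_≤ x * (x + 1) + 1) (+-comm (x + 1) 1) (+-monoˡ-≤ 1 (m≤n*m (x + 1) x {{>-nonZero x≥1}})))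
            (≤-trans x[x+1]+1≤b b≤y)
  cancelled : y * (x * (x + 1) + 1) ≤ (x + 1) * (x * y + 1)
  cancelled = *-cancelʳ-≤ _ _ C (begin
    y * (x * (x + 1) + 1) * C      ≤⟨ *-monoˡ-≤ C (*-monoʳ-≤ y x[x+1]+1≤b) ⟩
    y * b * C                      ≡⟨ *-assoc y b C ⟩
    y * (b * C)                    ≤⟨ lower ⟩
    (x * C + y + 1) * (x * y + 1)  ≤⟨ *-monoˡ-≤ (x * y + 1) (subst (_≤ x * C + C) (sym (+-assoc (x * C) y 1)) xC+[y+1]≤xC+C) ⟩
    (x * C + C) * (x * y + 1)      ≡⟨ e₂ x y C ⟩
    (x + 1) * (x * y + 1) * C      ∎)
    where
    open ≤-Reasoning
    xC+[y+1]≤xC+C : x * C + (y + 1) ≤ x * C + C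
    xC+[y+1]≤xC+C = +-monoʳ-≤ (x * C) (subst (_≤ C) (+-comm 1 y) y<C)
    e₂ : ∀ x y C → (x * C + C) * (x * y + 1) ≡ (x + 1) * (x * y + 1) * C
    e₂ = solve-∀
  e₁ : ∀ x y → y * (x * (x + 1) + 1) + (x + 1) ≡ (x + 1) * (x * y + 1) + y
  e₁ = solve-∀

x<k⇒x*[x+1]≤k*k : ∀ {x k} → x < k → x * (x + 1) ≤ k * k
x<k⇒x*[x+1]≤k*k {x} {k} x<k = *-mono-≤ (<⇒≤ x<k) (subst (_≤ k) (+-comm 1 x) x<k)

square-bracket-unique : ∀ {n x k} → x * x < n → n ≤ x * (x + 1) → k * k < n → n ≤ k * (k + 1) → x ≡ k
square-bracket-unique {n} {x} {k} x²<n n≤x[x+1] k²<n n≤k[k+1] with <-cmp x k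
... | tri≈ _ x≡k _ = x≡k
... | tri< x<k _ _ = ⊥-elim (<⇒≱ k²<n (≤-trans n≤x[x+1] (x<k⇒x*[x+1]≤k*k x<k)))
... | tri> _ _ k<x = ⊥-elim (<⇒≱ x²<n (≤-trans n≤k[k+1] (x<k⇒x*[x+1]≤k*k k<x)))

k*k+k≡k*[k+1] : ∀ k → k * k + k ≡ k * (k + 1)
k*k+k≡k*[k+1] = solve-∀

case-k²+1 : ∀ {b x y l} k → b ≡ k * k + 1 → 2 ≤ k → (k + 4) * b ≤ b ^ l →
  x * x < b → b ≤ x * (x + 1) → b ≤ y →
  y * (b * b ^ l) ≤ (x * b ^ l + y + 1) * (x * y + 1) →
  (x * b ^ l + y) * (x * (y + 1) + 1) ≤ (y + 1) * (b * b ^ l) →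
  k * (y + 1) ≡ b ^ l ∸ b
case-k²+1 {x = x} {y} {l} k refl k≥2 C-large x²<b b≤x[x+1] b≤y lower upper
  with square-bracket-unique {x = x} {k} x²<b b≤x[x+1] (m<m+n (k * k) z<s)
         (≤-trans (+-monoʳ-≤ (k * k) (≤-trans z<s k≥2)) (≤-reflexive (k*k+k≡k*[k+1] k)))
... | refl = sym (trans (cong (_∸ b) C≡) (m+n∸n≡m (k * (y + 1)) b))
  where
  b = k * k + 1
  C = b ^ l
  k<y : k < y
  k<y = ≤-trans (subst (_≤ b) (+-comm k 1) (+-monoˡ-≤ 1 (m≤m*n k k {{>-nonZero (≤-trans z<s k≥2)}}))) b≤y
  C≡ : C ≡ k * (y + 1) + b
  C≡ = k²+1-C-exact k y C (proj₁ (k*Q+1-pow k k l)) k≥2 k<y (proj₂ (k*Q+1-pow k k l)) C-large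
         (lower-bound-reduced k 1 y C lower) (upper-bound-reduced k 1 y C upper)

case-k²+k : ∀ {b x y l} k → b ≡ k * k + k → 2 ≤ k → b * b ≤ b ^ l →
  x * x < b → b ≤ x * (x + 1) → b ≤ y →
  y * (b * b ^ l) ≤ (x * b ^ l + y + 1) * (x * y + 1) →
  (x * b ^ l + y) * (x * (y + 1) + 1) ≤ (y + 1) * (b * b ^ l) →
  y ≡ b ^ l ∸ 2
case-k²+k {x = x} {y} {l} k refl k≥2 b²≤C x²<b b≤x[x+1] b≤y lower upper
  with square-bracket-unique {x = x} {k} x²<b b≤x[x+1] (m<m+n (k * k) (≤-trans z<s k≥2))
         (≤-reflexive (k*k+k≡k*[k+1] k))
... | refl = sym (cong (_∸ 2) (k²+k-C-exact k y C k≥2 b≤y b²≤C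
                 (lower-bound-reduced k k y C lower) (upper-bound-reduced k k y C upper)))
  where
  C = (k * k + k) ^ l

k+4≤k*k+1 : ∀ {k} → 3 ≤ k → k + 4 ≤ k * k + 1
k+4≤k*k+1 {k} k≥3 = subst (_≤ k * k + 1) (+-assoc k 3 1) (+-monoˡ-≤ 1 (begin
  k + 3          ≤⟨ +-monoʳ-≤ k (≤-trans k≥3 (m≤m+n k (k + 0))) ⟩
  3 * k          ≤⟨ *-monoˡ-≤ k k≥3 ⟩
  k * k          ∎))
  where open ≤-Reasoning

b*b≤b^l : ∀ b .{{_ : NonZero b}} l → 2 ≤ l → b * b ≤ b ^ l
b*b≤b^l b l l≥2 = subst (_≤ b ^ l) (cong (b *_) (*-identityʳ b)) (^-monoʳ-≤ b l≥2)

second-quotient-formulas : ∀ b .{{_ : NonZero b}} x y d l → 2 ≤ b → 1 ≤ x → b ^ (d ∸ 1) ≤ x →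
  b ^ (l ∸ 1) ≤ y → y < b ^ l → 2 ≤ l →
  (x * b ^ l + y) * x ≤ b ^ d * b ^ l ×
  y * (b ^ d * b ^ l) ≤ (x * b ^ l + y + 1) * (x * y + 1) ×
  (x * b ^ l + y) * (x * (y + 1) + 1) ≤ (y + 1) * (b ^ d * b ^ l) →
  ((∀ k → 3 ≤ k → b ≡ k * k + 1 → k * (y + 1) ≡ b ^ l ∸ b) ×
   (b ≡ 5 → 3 ≤ l → 2 * (y + 1) ≡ b ^ l ∸ b)) ×
  (∀ k → 2 ≤ k → b ≡ k * k + k → y ≡ b ^ l ∸ 2)
second-quotient-formulas b x y d l b≥2 x≥1 b^d≤x b^l≤y y<C l≥2 (first , second , third)
  with [x*C+y]*x≤B*C⇒x*x<B x y (b ^ d) (b ^ l) x≥1 (≤-trans (m^n>0 b (l ∸ 1)) b^l≤y) first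
... | x²<b^d with x*x<b^d⇒d≡1 b x d x≥1 b^d≤x x²<b^d
...   | refl = (case-I , case-5) , case-II
  where
  C = b ^ l
  b¹≡b : b ^ 1 ≡ b
  b¹≡b = *-identityʳ b
  x²<b : x * x < b
  x²<b = subst (x * x <_) b¹≡b x²<b^d
  lower : y * (b * C) ≤ (x * C + y + 1) * (x * y + 1)
  lower = subst (λ B → y * (B * C) ≤ (x * C + y + 1) * (x * y + 1)) b¹≡b second
  upper : (x * C + y) * (x * (y + 1) + 1) ≤ (y + 1) * (b * C)
  upper = subst (λ B → (x * C + y) * (x * (y + 1) + 1) ≤ (y + 1) * (B * C)) b¹≡b third
  b≤y : b ≤ y
  b≤y = ≤-trans (≤-trans (≤-reflexive (sym b¹≡b)) (^-monoʳ-≤ b (∸-monoˡ-≤ 1 l≥2))) b^l≤y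
  b≤x[x+1] : b ≤ x * (x + 1)
  b≤x[x+1] = b≤x*[x+1] b x y C x≥1 b≤y y<C lower
  case-I : ∀ k → 3 ≤ k → b ≡ k * k + 1 → k * (y + 1) ≡ C ∸ b
  case-I k k≥3 b≡ = case-k²+1 {x = x} {l = l} k b≡ (≤-trans (s≤s (s≤s z≤n)) k≥3)
    (≤-trans (*-monoˡ-≤ b (subst (k + 4 ≤_) (sym b≡) (k+4≤k*k+1 k≥3))) (b*b≤b^l b l l≥2))
    x²<b b≤x[x+1] b≤y lower upper
  -- For k = 2 the bound C ≥ b² is too weak; C ≥ b³ (that is, l ≥ 3) suffices.
  case-5 : b ≡ 5 → 3 ≤ l → 2 * (y + 1) ≡ C ∸ b
  case-5 b≡5 l≥3 = case-k²+1 {x = x} {l = l} 2 b≡5 ≤-refl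
    (subst (λ b → 6 * b ≤ b ^ l) (sym b≡5) (≤-trans (m≤m+n 30 95) (^-monoʳ-≤ 5 l≥3)))
    x²<b b≤x[x+1] b≤y lower upper
  case-II : ∀ k → 2 ≤ k → b ≡ k * k + k → y ≡ C ∸ 2
  case-II k k≥2 b≡ = case-k²+k {x = x} {l = l} k b≡ k≥2 (b*b≤b^l b l l≥2) x²<b b≤x[x+1] b≤y lower upper

corollary6p3 : (b : ℕ) .{{_ : NonZero b}} → 2 ≤ b →
    (a : ℕ → ℕ) → IsTrott b a →
    (l : ℕ) → 2 ≤ l → numDigits b (a 1) ≡ l →
    ((∀ k → 3 ≤ k → b ≡ k * k + 1 → k * (a 1 + 1) ≡ b ^ l ∸ b) ×
     (b ≡ 5 → 3 ≤ l → 2 * (a 1 + 1) ≡ b ^ l ∸ b)) ×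
    (∀ k → 2 ≤ k → b ≡ k * k + k → a 1 ≡ b ^ l ∸ 2)
corollary6p3 b b≥2 a trott@(pos , _) l l≥2 refl =
  second-quotient-formulas b (a 0) (a 1) (numDigits b (a 0)) l b≥2 (pos 0)
    (proj₂ (numDigits-bounds b b≥2 (a 0) (pos 0))) (proj₂ digits₁) (proj₁ digits₁) l≥2
    (trott-two-blocks b b≥2 a trott)
  where
  digits₁ = numDigits-bounds b b≥2 (a 1) (pos 1)
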